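{- (Bounded substitution theorem for $\mathcal{MG}^c$.) For every pattern $\varphi$ and element variables $x,y$ such that $y$ does not occur in $\varphi$, $\vdash_{\mathcal{MG}^c}\varphi\leftrightarrow\mathrm{Subb}_x^y\varphi$.
   Context: Fix a countably infinite set $EVar$ of element variables and a set $\Sigma$ of constant symbols containing a distinguished "definedness symbol" $\lceil\,\rceil$. Patterns: $\varphi::= x\mid \sigma\mid \bot\mid \neg\varphi\mid \varphi\to\varphi\mid \varphi\wedge\varphi\mid\varphi\vee\varphi\mid \varphi\cdot\varphi\mid \forall x\varphi\mid\exists x\varphi$ ($\varphi\cdot\psi$ is application). Abbreviations: $\varphi\leftrightarrow\psi:=(\varphi\to\psi)\wedge(\psi\to\varphi)$, $\lceil\varphi\rceil:=\lceil\,\rceil\cdot\varphi$, $\lfloor\varphi\rfloor:=\neg\lceil\neg\varphi\rceil$, $\varphi=\psi:=\lfloor\varphi\leftrightarrow\psi\rfloor$. An occurrence of $x$ is bound if inside a subpattern $\forall x\eta$ or $\exists x\eta$, otherwise free. $\mathrm{Subf}_x^y\varphi$ replaces every free occurrence of $x$ by $y$. Bounded substitution $\mathrm{Subb}_x^y\varphi$ (renaming the bound occurrences of $x$ into $y$) is defined recursively: it is $\varphi$ for atomic $\varphi$; it commutes with $\neg,\to,\wedge,\vee$ and application; $\mathrm{Subb}_x^y(Qz\eta)=Qz\,\mathrm{Subb}_x^y\eta$ for $z\neq x$, and $\mathrm{Subb}_x^y(Qx\eta)=Qy\,\mathrm{Subf}_x^y(\mathrm{Subb}_x^y\eta)$,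 for $Q\in\{\forall,\exists\}$. $\vdash\psi$ means there is a finite sequence ending in $\psi$ of axiom instances or consequences of earlier members by rules. Proof system $\mathcal{MG}^c$. Axioms: $\varphi\vee\varphi\to\varphi$; $\varphi\to\varphi\wedge\varphi$; $\varphi\to\varphi\vee\psi$; $\varphi\wedge\psi\to\varphi$; $\varphi\vee\psi\to\psi\vee\varphi$; $\varphi\wedge\psi\to\psi\wedge\varphi$; $\bot\to\varphi$; $\varphi\vee\neg\varphi$; $\neg\varphi\to(\varphi\to\bot)$; $(\varphi\to\bot)\to\neg\varphi$; $\forall x(\varphi\to\psi)\to(\forall x\varphi\to\forall x\psi)$; $\varphi\to\forall x\varphi$ if $x$ does not occur in $\varphi$; $\exists x(x=y)$ for $y$ distinct from $x$; $\exists x\varphi\to\neg\forall x\neg\varphi$; $\neg\forall x\neg\varphi\to\exists x\varphi$; $(\varphi\vee\psi)\cdot\chi\to\varphi\cdot\chi\vee\psi\cdot\chi$; $\chi\cdot(\varphi\vee\psi)\to\chi\cdot\varphi\vee\chi\cdot\psi$; $(\exists x\varphi)\cdot\psi\to\exists x(\varphi\cdot\psi)$ and $\psi\cdot(\exists x\varphi)\to\exists x(\psi\cdot\varphi)$ if $x$ does not occur in $\psi$; $\lceil\varphi\rceil\cdot\psi\to\lceil\varphi\rceil$; $\psi\cdot\lceil\varphi\rceil\to\lceil\varphi\rceil$; $\lceil x\rceil$; $\varphi\to\lceil\varphi\rceil$; $\lceil\bot\rceil\to\bot$. Rules: from $\varphi$, $\varphi\to\psi$ infer $\psi$; from $\varphi\to\psi$,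 $\psi\to\chi$ infer $\varphi\to\chi$; from $\varphi\wedge\psi\to\chi$ infer $\varphi\to(\psi\to\chi)$; from $\varphi\to(\psi\to\chi)$ infer $\varphi\wedge\psi\to\chi$; from $\varphi\to\psi$ infer $\chi\vee\varphi\to\chi\vee\psi$; from $\varphi$ infer $\forall x\varphi$; from $\varphi\to\psi$ infer $\varphi\cdot\chi\to\psi\cdot\chi$ and $\chi\cdot\varphi\to\chi\cdot\psi$. -}

module Defs where

open import Data.Nat using (ℕ; _≟_)
open import Relation.Nullary using (¬_; yes; no)
open import Relation.Binary.PropositionalEquality using (_≡_; _≢_)

EVar : Set
EVar = ℕ

data Pattern (Σ : Set) : Set where
  var   : EVar → Pattern Σ
  sym   : Σ → Pattern Σ
  ⊥p    : Pattern Σ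
  ¬p_   : Pattern Σ → Pattern Σ
  _⇒_   : Pattern Σ → Pattern Σ → Pattern Σ
  _∧p_  : Pattern Σ → Pattern Σ → Pattern Σ
  _∨p_  : Pattern Σ → Pattern Σ → Pattern Σ
  _·_   : Pattern Σ → Pattern Σ → Pattern Σ
  ∀p    : EVar → Pattern Σ → Pattern Σ
  ∃p    : EVar → Pattern Σ → Pattern Σ

infix  30 ¬p_
infixl 25 _·_
infixl 20 _∧p_
infixl 19 _∨p_
infixr 15 _⇒_

module _ {Σ : Set} where

  infix  12 _⇔_

  _⇔_ : Pattern Σ → Pattern Σ → Pattern Σ
  φ ⇔ ψ = (φ ⇒ ψ) ∧p (ψ ⇒ φ)

  -- x occurs (free or bound, including as a binder) in a pattern
  data Occurs (x : EVar) : Pattern Σ → Set where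
    o-var  : Occurs x (var x)
    o-¬    : ∀ {φ} → Occurs x φ → Occurs x (¬p φ)
    o-⇒ˡ   : ∀ {φ ψ} → Occurs x φ → Occurs x (φ ⇒ ψ)
    o-⇒ʳ   : ∀ {φ ψ} → Occurs x ψ → Occurs x (φ ⇒ ψ)
    o-∧ˡ   : ∀ {φ ψ} → Occurs x φ → Occurs x (φ ∧p ψ)
    o-∧ʳ   : ∀ {φ ψ} → Occurs x ψ → Occurs x (φ ∧p ψ)
    o-∨ˡ   : ∀ {φ ψ} → Occurs x φ → Occurs x (φ ∨p ψ)
    o-∨ʳ   : ∀ {φ ψ} → Occurs x ψ → Occurs x (φ ∨p ψ)
    o-·ˡ   : ∀ {φ ψ} → Occurs x φ → Occurs x (φ · ψ)
    o-·ʳ   : ∀ {φ ψ} → Occurs x ψ → Occurs x (φ · ψ)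
    o-∀b   : ∀ {φ} → Occurs x (∀p x φ)
    o-∀    : ∀ {z φ} → Occurs x φ → Occurs x (∀p z φ)
    o-∃b   : ∀ {φ} → Occurs x (∃p x φ)
    o-∃    : ∀ {z φ} → Occurs x φ → Occurs x (∃p z φ)

  Subf : EVar → EVar → Pattern Σ → Pattern Σ
  Subf x y (var z) with z ≟ x
  ... | yes _ = var y
  ... | no  _ = var z
  Subf x y (sym s)   = sym s
  Subf x y ⊥p        = ⊥p
  Subf x y (¬p φ)    = ¬p Subf x y φ
  Subf x y (φ ⇒ ψ)   = Subf x y φ ⇒ Subf x y ψ
  Subf x y (φ ∧p ψ)  = Subf x y φ ∧p Subf x y ψ
  Subf x y (φ ∨p ψ)  = Subf x y φ ∨p Subf x y ψ
  Subf x y (φ · ψ)   = Subf x y φ · Subf x y ψ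
  Subf x y (∀p z φ) with z ≟ x
  ... | yes _ = ∀p z φ
  ... | no  _ = ∀p z (Subf x y φ)
  Subf x y (∃p z φ) with z ≟ x
  ... | yes _ = ∃p z φ
  ... | no  _ = ∃p z (Subf x y φ)

  -- Subb x y φ : rename the bound occurrences of x into y
  Subb : EVar → EVar → Pattern Σ → Pattern Σ
  Subb x y (var z)   = var z
  Subb x y (sym s)   = sym s
  Subb x y ⊥p        = ⊥p
  Subb x y (¬p φ)    = ¬p Subb x y φ
  Subb x y (φ ⇒ ψ)   = Subb x y φ ⇒ Subb x y ψ
  Subb x y (φ ∧p ψ)  = Subb x y φ ∧p Subb x y ψ
  Subb x y (φ ∨p ψ)  = Subb x y φ ∨p Subb x y ψ
  Subb x y (φ · ψ)   = Subb x y φ · Subb x y ψ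
  Subb x y (∀p z φ) with z ≟ x
  ... | yes _ = ∀p y (Subf x y (Subb x y φ))
  ... | no  _ = ∀p z (Subb x y φ)
  Subb x y (∃p z φ) with z ≟ x
  ... | yes _ = ∃p y (Subf x y (Subb x y φ))
  ... | no  _ = ∃p z (Subb x y φ)

module MG {Σ : Set} (def : Σ) where

  ⌈_⌉ : Pattern Σ → Pattern Σ
  ⌈ φ ⌉ = sym def · φ

  ⌊_⌋ : Pattern Σ → Pattern Σ
  ⌊ φ ⌋ = ¬p ⌈ ¬p φ ⌉

  _≐_ : Pattern Σ → Pattern Σ → Pattern Σ
  φ ≐ ψ = ⌊ φ ⇔ ψ ⌋

  data ⊢_ : Pattern Σ → Set where
    ax-∨idem  : ∀ {φ} → ⊢ (φ ∨p φ ⇒ φ)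
    ax-∧dup   : ∀ {φ} → ⊢ (φ ⇒ φ ∧p φ)
    ax-∨intro : ∀ {φ ψ} → ⊢ (φ ⇒ φ ∨p ψ)
    ax-∧elim  : ∀ {φ ψ} → ⊢ (φ ∧p ψ ⇒ φ)
    ax-∨comm  : ∀ {φ ψ} → ⊢ (φ ∨p ψ ⇒ ψ ∨p φ)
    ax-∧comm  : ∀ {φ ψ} → ⊢ (φ ∧p ψ ⇒ ψ ∧p φ)
    ax-⊥      : ∀ {φ} → ⊢ (⊥p ⇒ φ)
    ax-lem    : ∀ {φ} → ⊢ (φ ∨p ¬p φ)
    ax-¬⇒     : ∀ {φ} → ⊢ (¬p φ ⇒ (φ ⇒ ⊥p))
    ax-⇒¬     : ∀ {φ} → ⊢ ((φ ⇒ ⊥p) ⇒ ¬p φ)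
    ax-∀K     : ∀ {x φ ψ} → ⊢ (∀p x (φ ⇒ ψ) ⇒ (∀p x φ ⇒ ∀p x ψ))
    ax-∀vac   : ∀ {x φ} → ¬ Occurs x φ → ⊢ (φ ⇒ ∀p x φ)
    ax-∃eq    : ∀ {x y} → x ≢ y → ⊢ (∃p x (var x ≐ var y))
    ax-∃⇒¬∀¬  : ∀ {x φ} → ⊢ (∃p x φ ⇒ ¬p ∀p x (¬p φ))
    ax-¬∀¬⇒∃  : ∀ {x φ} → ⊢ (¬p ∀p x (¬p φ) ⇒ ∃p x φ)
    ax-prop∨ˡ : ∀ {φ ψ χ} → ⊢ ((φ ∨p ψ) · χ ⇒ φ · χ ∨p ψ · χ)
    ax-prop∨ʳ : ∀ {φ ψ χ} → ⊢ (χ · (φ ∨p ψ) ⇒ χ · φ ∨p χ · ψ)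
    ax-prop∃ˡ : ∀ {x φ ψ} → ¬ Occurs x ψ → ⊢ ((∃p x φ) · ψ ⇒ ∃p x (φ · ψ))
    ax-prop∃ʳ : ∀ {x φ ψ} → ¬ Occurs x ψ → ⊢ (ψ · (∃p x φ) ⇒ ∃p x (ψ · φ))
    ax-defˡ   : ∀ {φ ψ} → ⊢ (⌈ φ ⌉ · ψ ⇒ ⌈ φ ⌉)
    ax-defʳ   : ∀ {φ ψ} → ⊢ (ψ · ⌈ φ ⌉ ⇒ ⌈ φ ⌉)
    ax-defvar : ∀ {x} → ⊢ ⌈ var x ⌉
    ax-def    : ∀ {φ} → ⊢ (φ ⇒ ⌈ φ ⌉)
    ax-def⊥   : ⊢ (⌈ ⊥p ⌉ ⇒ ⊥p)
    r-mp      : ∀ {φ ψ} → ⊢ φ → ⊢ (φ ⇒ ψ) → ⊢ ψ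
    r-trans   : ∀ {φ ψ χ} → ⊢ (φ ⇒ ψ) → ⊢ (ψ ⇒ χ) → ⊢ (φ ⇒ χ)
    r-exp     : ∀ {φ ψ χ} → ⊢ (φ ∧p ψ ⇒ χ) → ⊢ (φ ⇒ (ψ ⇒ χ))
    r-imp     : ∀ {φ ψ χ} → ⊢ (φ ⇒ (ψ ⇒ χ)) → ⊢ (φ ∧p ψ ⇒ χ)
    r-∨mono   : ∀ {φ ψ χ} → ⊢ (φ ⇒ ψ) → ⊢ (χ ∨p φ ⇒ χ ∨p ψ)
    r-gen     : ∀ {x φ} → ⊢ φ → ⊢ (∀p x φ)
    r-frameˡ  : ∀ {φ ψ χ} → ⊢ (φ ⇒ ψ) → ⊢ (φ · χ ⇒ ψ · χ)
    r-frameʳ  : ∀ {φ ψ χ} → ⊢ (φ ⇒ ψ) → ⊢ (χ · φ ⇒ χ · ψ)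

-- Induction on φ: every connective is a congruence for provable equivalence, so the real case is a
-- binder, ∀x ψ against ∀y ψ′ with ψ′ = Subf x y ψ₀ and ψ₀ = Subb x y ψ ⊣⊢ ψ. As y is fresh,
-- ∀x ψ ⇒ ∀y ∀x ψ, and ∀x ψ ⇒ ψ′ by instantiating x at y: the axiom ∃x (x = y) supplies the witness,
-- and Leibniz's law turns x = y ∧ ψ₀ into ψ′. Leibniz's law holds by induction because the context
-- ⌊x ⇔ y⌋ is a ⌊_⌋-pattern, which passes through applications, and mentions only x and y, so it
-- passes through the remaining binders. The converse is symmetric, and ∃ is dual to ∀.
module Submission where

open import Defs
open import Relation.Nullary using (¬_; yes; no)
open import Data.Nat using (_≟_)
open import Data.Product using (_×_; _,_; proj₁; proj₂)
open import Data.Sum using (_⊎_; inj₁; inj₂; [_,_]′)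
open import Data.Empty using (⊥-elim)
open import Function using (_∘_)
open import Relation.Binary.PropositionalEquality
  using (_≡_; _≢_; refl; cong; cong₂; subst; ≢-sym) renaming (sym to ≡-sym)

module _ {Σ : Set} (def : Σ) where
  open MG def

  private variable
    x y z : EVar
    φ ψ A B C A' B' Γ P : Pattern Σ

  _∉_ : EVar → Pattern Σ → Set
  x ∉ φ = ¬ Occurs x φ

  infixr 5 _⨾_
  _⨾_ : ⊢ (A ⇒ B) → ⊢ (B ⇒ C) → ⊢ (A ⇒ C)
  _⨾_ = r-trans

  ⇒-refl : ⊢ (A ⇒ A)
  ⇒-refl = ax-∧dup ⨾ ax-∧elim

  ⇒-const : ⊢ B → ⊢ (A ⇒ B)
  ⇒-const b = r-mp b (r-exp ax-∧elim)

  ⇒-swap : ⊢ (A ⇒ (B ⇒ C)) → ⊢ (B ⇒ (A ⇒ C))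
  ⇒-swap f = r-exp (ax-∧comm ⨾ r-imp f)

  ⇒-elim : ⊢ ((A ⇒ B) ∧p A ⇒ B)
  ⇒-elim = r-imp ⇒-refl

  ∧-elimˡ : ⊢ (A ∧p B ⇒ A)
  ∧-elimˡ = ax-∧elim

  ∧-elimʳ : ⊢ (A ∧p B ⇒ B)
  ∧-elimʳ = ax-∧comm ⨾ ax-∧elim

  ∧-mapʳ : ⊢ (B ⇒ B') → ⊢ (A ∧p B ⇒ A ∧p B')
  ∧-mapʳ g = r-imp (⇒-swap (g ⨾ ⇒-swap (r-exp ⇒-refl)))

  ∧-mapˡ : ⊢ (A ⇒ A') → ⊢ (A ∧p B ⇒ A' ∧p B)
  ∧-mapˡ f = ax-∧comm ⨾ ∧-mapʳ f ⨾ ax-∧comm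

  ∧-map : ⊢ (A ⇒ A') → ⊢ (B ⇒ B') → ⊢ (A ∧p B ⇒ A' ∧p B')
  ∧-map f g = ∧-mapˡ f ⨾ ∧-mapʳ g

  ∧-intro : ⊢ (A ⇒ B) → ⊢ (A ⇒ C) → ⊢ (A ⇒ B ∧p C)
  ∧-intro f g = ax-∧dup ⨾ ∧-map f g

  ∨-introˡ : ⊢ (A ⇒ A ∨p B)
  ∨-introˡ = ax-∨intro

  ∨-introʳ : ⊢ (B ⇒ A ∨p B)
  ∨-introʳ = ax-∨intro ⨾ ax-∨comm

  ∨-elim : ⊢ (A ⇒ C) → ⊢ (B ⇒ C) → ⊢ (A ∨p B ⇒ C)
  ∨-elim f g = r-∨mono g ⨾ ax-∨comm ⨾ r-∨mono f ⨾ ax-∨idem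

  ∨-elimᶜ : ⊢ (Γ ∧p A ⇒ C) → ⊢ (Γ ∧p B ⇒ C) → ⊢ (Γ ∧p (A ∨p B) ⇒ C)
  ∨-elimᶜ f g = r-imp (⇒-swap (∨-elim (⇒-swap (r-exp f)) (⇒-swap (r-exp g))))

  ∨-map : ⊢ (A ⇒ A') → ⊢ (B ⇒ B') → ⊢ (A ∨p B ⇒ A' ∨p B')
  ∨-map f g = ∨-elim (f ⨾ ∨-introˡ) (g ⨾ ∨-introʳ)

  ¬-elim : ⊢ (¬p A ∧p A ⇒ ⊥p)
  ¬-elim = r-imp ax-¬⇒

  ¬-intro : ⊢ (Γ ∧p A ⇒ ⊥p) → ⊢ (Γ ⇒ ¬p A)
  ¬-intro f = r-exp f ⨾ ax-⇒¬

  ¬¬-elim : ⊢ (¬p ¬p A ⇒ A)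
  ¬¬-elim = ∧-intro ⇒-refl (⇒-const ax-lem) ⨾ ∨-elimᶜ ∧-elimʳ (¬-elim ⨾ ax-⊥)

  case-split : ⊢ (A ⇒ (C ∧p A) ∨p ¬p C)
  case-split = ∧-intro ⇒-refl (⇒-const ax-lem) ⨾ ∨-elimᶜ (ax-∧comm ⨾ ∨-introˡ) (∧-elimʳ ⨾ ∨-introʳ)

  ¬¬-intro : ⊢ (A ⇒ ¬p ¬p A)
  ¬¬-intro = ¬-intro (ax-∧comm ⨾ ¬-elim)

  contrapositive : ⊢ ((A ⇒ B) ⇒ (¬p B ⇒ ¬p A))
  contrapositive = r-exp (¬-intro (∧-intro (∧-elimˡ ⨾ ∧-elimʳ) (∧-map ∧-elimˡ ⇒-refl ⨾ ⇒-elim) ⨾ ¬-elim))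

  contraposition : ⊢ (A ⇒ B) → ⊢ (¬p B ⇒ ¬p A)
  contraposition f = r-mp f contrapositive

  ⇒-map : ⊢ (A' ⇒ A) → ⊢ (B ⇒ B') → ⊢ ((A ⇒ B) ⇒ (A' ⇒ B'))
  ⇒-map f g = r-exp (∧-mapʳ f ⨾ ⇒-elim ⨾ g)

  ·-map : ⊢ (A ⇒ A') → ⊢ (B ⇒ B') → ⊢ (A · B ⇒ A' · B')
  ·-map f g = r-frameˡ f ⨾ r-frameʳ g

  ∀-mono : ⊢ (A ⇒ B) → ⊢ (∀p x A ⇒ ∀p x B)
  ∀-mono f = r-mp (r-gen f) ax-∀K

  -- Contrapose P ∧ A ⇒ B under ∀x: then ¬B ⇒ ∀x ¬B (as x ∉ B) ⇒ ∀x ¬P, which ∃x P refutes.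
  ∀-elim : ⊢ (∃p x P) → ⊢ (P ∧p A ⇒ B) → x ∉ B → ⊢ (∀p x A ⇒ B)
  ∀-elim {x = x} {P = P} ∃P f x∉B =
    ∀-mono (⇒-swap (r-exp f) ⨾ contrapositive) ⨾ ax-∀K
      ⨾ ⇒-map (ax-∀vac λ { (o-¬ o) → x∉B o }) ∀¬P-absurd ⨾ ax-⇒¬ ⨾ ¬¬-elim
    where
    ∀¬P-absurd : ⊢ (∀p x (¬p P) ⇒ ⊥p)
    ∀¬P-absurd = ∧-intro (⇒-const (r-mp ∃P ax-∃⇒¬∀¬)) ⇒-refl ⨾ ¬-elim

  ⌊⌋-elim : ⊢ (⌊ A ⌋ ⇒ A)
  ⌊⌋-elim = contraposition ax-def ⨾ ¬¬-elim

  ⌊⌋-mono : ⊢ (A ⇒ B) → ⊢ (⌊ A ⌋ ⇒ ⌊ B ⌋)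
  ⌊⌋-mono f = contraposition (r-frameʳ (contraposition f))

  -- Split A on ⌊P⌋; the other case ¬⌊P⌋ is a ⌈_⌉-pattern, which absorbs the application.
  ⌊⌋-∧-frameˡ : ⊢ (⌊ P ⌋ ∧p A · B ⇒ (⌊ P ⌋ ∧p A) · B)
  ⌊⌋-∧-frameˡ {P = P} {A = A} {B = B} = ∧-mapʳ split ⨾ ∨-elimᶜ ∧-elimʳ (ax-∧comm ⨾ ¬-elim ⨾ ax-⊥)
    where
    split : ⊢ (A · B ⇒ (⌊ P ⌋ ∧p A) · B ∨p ¬p ⌊ P ⌋)
    split = r-frameˡ case-split ⨾ ax-prop∨ˡ ⨾ ∨-map ⇒-refl (r-frameˡ ¬¬-elim ⨾ ax-defˡ ⨾ ¬¬-intro)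

  ⌊⌋-∧-frameʳ : ⊢ (⌊ P ⌋ ∧p B · A ⇒ B · (⌊ P ⌋ ∧p A))
  ⌊⌋-∧-frameʳ {P = P} {B = B} {A = A} = ∧-mapʳ split ⨾ ∨-elimᶜ ∧-elimʳ (ax-∧comm ⨾ ¬-elim ⨾ ax-⊥)
    where
    split : ⊢ (B · A ⇒ B · (⌊ P ⌋ ∧p A) ∨p ¬p ⌊ P ⌋)
    split = r-frameʳ case-split ⨾ ax-prop∨ʳ ⨾ ∨-map ⇒-refl (r-frameʳ ¬¬-elim ⨾ ax-defʳ ⨾ ¬¬-intro)

  infix 4 _⊣⊢_ _⊣⊢[_]_

  _⊣⊢_ : Pattern Σ → Pattern Σ → Set
  A ⊣⊢ B = ⊢ (A ⇒ B) × ⊢ (B ⇒ A)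

  _⊣⊢[_]_ : Pattern Σ → Pattern Σ → Pattern Σ → Set
  A ⊣⊢[ Γ ] B = ⊢ (Γ ∧p A ⇒ B) × ⊢ (Γ ∧p B ⇒ A)

  ⊣⊢-refl : A ⊣⊢ A
  ⊣⊢-refl = ⇒-refl , ⇒-refl

  ⊣⊢⇒⇔ : A ⊣⊢ B → ⊢ (A ⇔ B)
  ⊣⊢⇒⇔ (f , g) = r-mp g (r-mp f (r-exp ⇒-refl))

  ¬-cong : A ⊣⊢ B → ¬p A ⊣⊢ ¬p B
  ¬-cong (f , g) = contraposition g , contraposition f

  ⇒-cong : A ⊣⊢ A' → B ⊣⊢ B' → (A ⇒ B) ⊣⊢ (A' ⇒ B')
  ⇒-cong (f , f') (g , g') = ⇒-map f' g , ⇒-map f g'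

  ∧-cong : A ⊣⊢ A' → B ⊣⊢ B' → A ∧p B ⊣⊢ A' ∧p B'
  ∧-cong (f , f') (g , g') = ∧-map f g , ∧-map f' g'

  ∨-cong : A ⊣⊢ A' → B ⊣⊢ B' → A ∨p B ⊣⊢ A' ∨p B'
  ∨-cong (f , f') (g , g') = ∨-map f g , ∨-map f' g'

  ·-cong : A ⊣⊢ A' → B ⊣⊢ B' → A · B ⊣⊢ A' · B'
  ·-cong (f , f') (g , g') = ·-map f g , ·-map f' g'

  ∀-cong : A ⊣⊢ B → ∀p x A ⊣⊢ ∀p x B
  ∀-cong (f , g) = ∀-mono f , ∀-mono g

  ∃-via-∀ : ∀p x (¬p A) ⊣⊢ ∀p y (¬p B) → ∃p x A ⊣⊢ ∃p y B
  ∃-via-∀ (f , g) = ax-∃⇒¬∀¬ ⨾ contraposition g ⨾ ax-¬∀¬⇒∃ , ax-∃⇒¬∀¬ ⨾ contraposition f ⨾ ax-¬∀¬⇒∃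

  ∃-cong : A ⊣⊢ B → ∃p x A ⊣⊢ ∃p x B
  ∃-cong = ∃-via-∀ ∘ ∀-cong ∘ ¬-cong

  ⊣⊢[]-refl : A ⊣⊢[ Γ ] A
  ⊣⊢[]-refl = ∧-elimʳ , ∧-elimʳ

  ¬-cong[] : A ⊣⊢[ Γ ] B → ¬p A ⊣⊢[ Γ ] ¬p B
  ¬-cong[] (f , g) = r-imp (r-exp g ⨾ contrapositive) , r-imp (r-exp f ⨾ contrapositive)

  ⇒-cong[] : A ⊣⊢[ Γ ] A' → B ⊣⊢[ Γ ] B' → (A ⇒ B) ⊣⊢[ Γ ] (A' ⇒ B')
  ⇒-cong[] (f , f') (g , g') = r-exp (along f' g) , r-exp (along f g')
    where
    along : ⊢ (Γ ∧p A' ⇒ A) → ⊢ (Γ ∧p B ⇒ B') → ⊢ ((Γ ∧p (A ⇒ B)) ∧p A' ⇒ B')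
    along h k = ∧-intro (∧-elimˡ ⨾ ∧-elimˡ) (∧-intro (∧-elimˡ ⨾ ∧-elimʳ) (∧-mapˡ ∧-elimˡ ⨾ h) ⨾ ⇒-elim) ⨾ k

  ∧-cong[] : A ⊣⊢[ Γ ] A' → B ⊣⊢[ Γ ] B' → A ∧p B ⊣⊢[ Γ ] A' ∧p B'
  ∧-cong[] (f , f') (g , g') = both f g , both f' g'
    where
    both : ⊢ (Γ ∧p A ⇒ A') → ⊢ (Γ ∧p B ⇒ B') → ⊢ (Γ ∧p (A ∧p B) ⇒ A' ∧p B')
    both h k = ∧-intro (∧-mapʳ ∧-elimˡ ⨾ h) (∧-mapʳ ∧-elimʳ ⨾ k)

  ∨-cong[] : A ⊣⊢[ Γ ] A' → B ⊣⊢[ Γ ] B' → A ∨p B ⊣⊢[ Γ ] A' ∨p B'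
  ∨-cong[] (f , f') (g , g') = ∨-elimᶜ (f ⨾ ∨-introˡ) (g ⨾ ∨-introʳ) , ∨-elimᶜ (f' ⨾ ∨-introˡ) (g' ⨾ ∨-introʳ)

  ·-cong[] : A ⊣⊢[ ⌊ P ⌋ ] A' → B ⊣⊢[ ⌊ P ⌋ ] B' → A · B ⊣⊢[ ⌊ P ⌋ ] A' · B'
  ·-cong[] (f , f') (g , g') = both f g , both f' g'
    where
    both : ⊢ (⌊ P ⌋ ∧p A ⇒ A') → ⊢ (⌊ P ⌋ ∧p B ⇒ B') → ⊢ (⌊ P ⌋ ∧p A · B ⇒ A' · B')
    both h k = ∧-intro ∧-elimˡ (⌊⌋-∧-frameˡ ⨾ r-frameˡ h) ⨾ ⌊⌋-∧-frameʳ ⨾ r-frameʳ k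

  ∀-cong[] : ⊢ (Γ ⇒ ∀p x Γ) → A ⊣⊢[ Γ ] B → ∀p x A ⊣⊢[ Γ ] ∀p x B
  ∀-cong[] Γ⇒∀Γ (f , g) = r-imp (Γ⇒∀Γ ⨾ ∀-mono (r-exp f) ⨾ ax-∀K) , r-imp (Γ⇒∀Γ ⨾ ∀-mono (r-exp g) ⨾ ax-∀K)

  ∃-cong[] : ⊢ (Γ ⇒ ∀p x Γ) → A ⊣⊢[ Γ ] B → ∃p x A ⊣⊢[ Γ ] ∃p x B
  ∃-cong[] Γ⇒∀Γ A⊣⊢B =
    let (f , g) = ¬-cong[] (∀-cong[] Γ⇒∀Γ (¬-cong[] A⊣⊢B))
    in ∧-mapʳ ax-∃⇒¬∀¬ ⨾ f ⨾ ax-¬∀¬⇒∃ , ∧-mapʳ ax-∃⇒¬∀¬ ⨾ g ⨾ ax-¬∀¬⇒∃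

  ∉-∀ : x ≢ z → x ∉ φ → x ∉ ∀p z φ
  ∉-∀ x≢z x∉φ o-∀b = x≢z refl
  ∉-∀ x≢z x∉φ (o-∀ o) = x∉φ o

  ∉-∃ : x ≢ z → x ∉ φ → x ∉ ∃p z φ
  ∉-∃ x≢z x∉φ o-∃b = x≢z refl
  ∉-∃ x≢z x∉φ (o-∃ o) = x∉φ o

  Subf-∉ : x ∉ φ → Subf x y φ ≡ φ
  Subf-∉ {x} {var z} x∉φ with z ≟ x
  ... | yes refl = ⊥-elim (x∉φ o-var)
  ... | no _ = refl
  Subf-∉ {φ = sym s} x∉φ = refl
  Subf-∉ {φ = ⊥p} x∉φ = refl
  Subf-∉ {φ = ¬p φ} x∉φ = cong ¬p_ (Subf-∉ (x∉φ ∘ o-¬))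
  Subf-∉ {φ = φ ⇒ ψ} x∉φ = cong₂ _⇒_ (Subf-∉ (x∉φ ∘ o-⇒ˡ)) (Subf-∉ (x∉φ ∘ o-⇒ʳ))
  Subf-∉ {φ = φ ∧p ψ} x∉φ = cong₂ _∧p_ (Subf-∉ (x∉φ ∘ o-∧ˡ)) (Subf-∉ (x∉φ ∘ o-∧ʳ))
  Subf-∉ {φ = φ ∨p ψ} x∉φ = cong₂ _∨p_ (Subf-∉ (x∉φ ∘ o-∨ˡ)) (Subf-∉ (x∉φ ∘ o-∨ʳ))
  Subf-∉ {φ = φ · ψ} x∉φ = cong₂ _·_ (Subf-∉ (x∉φ ∘ o-·ˡ)) (Subf-∉ (x∉φ ∘ o-·ʳ))
  Subf-∉ {x} {∀p z φ} x∉φ with z ≟ x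
  ... | yes _ = refl
  ... | no _ = cong (∀p z) (Subf-∉ (x∉φ ∘ o-∀))
  Subf-∉ {x} {∃p z φ} x∉φ with z ≟ x
  ... | yes _ = refl
  ... | no _ = cong (∃p z) (Subf-∉ (x∉φ ∘ o-∃))

  ∉-Subf-Subb : x ≢ y → (φ : Pattern Σ) → x ∉ Subf x y (Subb x y φ)
  ∉-Subf-Subb {x} x≢y (var z) o with z ≟ x
  ∉-Subf-Subb x≢y (var z) o-var | yes _ = x≢y refl
  ∉-Subf-Subb x≢y (var z) o-var | no z≢x = z≢x refl
  ∉-Subf-Subb x≢y (¬p φ) (o-¬ o) = ∉-Subf-Subb x≢y φ o
  ∉-Subf-Subb x≢y (φ ⇒ ψ) (o-⇒ˡ o) = ∉-Subf-Subb x≢y φ o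
  ∉-Subf-Subb x≢y (φ ⇒ ψ) (o-⇒ʳ o) = ∉-Subf-Subb x≢y ψ o
  ∉-Subf-Subb x≢y (φ ∧p ψ) (o-∧ˡ o) = ∉-Subf-Subb x≢y φ o
  ∉-Subf-Subb x≢y (φ ∧p ψ) (o-∧ʳ o) = ∉-Subf-Subb x≢y ψ o
  ∉-Subf-Subb x≢y (φ ∨p ψ) (o-∨ˡ o) = ∉-Subf-Subb x≢y φ o
  ∉-Subf-Subb x≢y (φ ∨p ψ) (o-∨ʳ o) = ∉-Subf-Subb x≢y ψ o
  ∉-Subf-Subb x≢y (φ · ψ) (o-·ˡ o) = ∉-Subf-Subb x≢y φ o
  ∉-Subf-Subb x≢y (φ · ψ) (o-·ʳ o) = ∉-Subf-Subb x≢y ψ o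
  ∉-Subf-Subb {x} {y} x≢y (∀p z φ) with z ≟ x
  ... | yes _ = subst (x ∉_) (≡-sym (Subf-∉ x∉∀)) x∉∀
    where
    x∉∀ : x ∉ ∀p y (Subf x y (Subb x y φ))
    x∉∀ = ∉-∀ x≢y (∉-Subf-Subb x≢y φ)
  ... | no z≢x with z ≟ x
  ...   | yes z≡x = ⊥-elim (z≢x z≡x)
  ...   | no _ = ∉-∀ (≢-sym z≢x) (∉-Subf-Subb x≢y φ)
  ∉-Subf-Subb {x} {y} x≢y (∃p z φ) with z ≟ x
  ... | yes _ = subst (x ∉_) (≡-sym (Subf-∉ x∉∃)) x∉∃
    where
    x∉∃ : x ∉ ∃p y (Subf x y (Subb x y φ))
    x∉∃ = ∉-∃ x≢y (∉-Subf-Subb x≢y φ)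
  ... | no z≢x with z ≟ x
  ...   | yes z≡x = ⊥-elim (z≢x z≡x)
  ...   | no _ = ∉-∃ (≢-sym z≢x) (∉-Subf-Subb x≢y φ)

  -- Substituting y for x captures nothing: binders are neither x nor y, except y over an x-free body.
  data Substitutable (x y : EVar) : Pattern Σ → Set where
    s-var : Substitutable x y (var z)
    s-sym : ∀ {s} → Substitutable x y (sym s)
    s-⊥   : Substitutable x y ⊥p
    s-¬   : Substitutable x y φ → Substitutable x y (¬p φ)
    s-⇒   : Substitutable x y φ → Substitutable x y ψ → Substitutable x y (φ ⇒ ψ)
    s-∧   : Substitutable x y φ → Substitutable x y ψ → Substitutable x y (φ ∧p ψ)
    s-∨   : Substitutable x y φ → Substitutable x y ψ → Substitutable x y (φ ∨p ψ)
    s-·   : Substitutable x y φ → Substitutable x y ψ → Substitutable x y (φ · ψ)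
    s-∀   : z ≢ x → z ≢ y → Substitutable x y φ → Substitutable x y (∀p z φ)
    s-∀y  : x ∉ φ → Substitutable x y (∀p y φ)
    s-∃   : z ≢ x → z ≢ y → Substitutable x y φ → Substitutable x y (∃p z φ)
    s-∃y  : x ∉ φ → Substitutable x y (∃p y φ)

  Subb-substitutable : x ≢ y → y ∉ φ → Substitutable x y (Subb x y φ)
  Subb-substitutable {φ = var z} x≢y y∉φ = s-var
  Subb-substitutable {φ = sym s} x≢y y∉φ = s-sym
  Subb-substitutable {φ = ⊥p} x≢y y∉φ = s-⊥
  Subb-substitutable {φ = ¬p φ} x≢y y∉φ = s-¬ (Subb-substitutable x≢y (y∉φ ∘ o-¬))
  Subb-substitutable {φ = φ ⇒ ψ} x≢y y∉φ =
    s-⇒ (Subb-substitutable x≢y (y∉φ ∘ o-⇒ˡ)) (Subb-substitutable x≢y (y∉φ ∘ o-⇒ʳ))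
  Subb-substitutable {φ = φ ∧p ψ} x≢y y∉φ =
    s-∧ (Subb-substitutable x≢y (y∉φ ∘ o-∧ˡ)) (Subb-substitutable x≢y (y∉φ ∘ o-∧ʳ))
  Subb-substitutable {φ = φ ∨p ψ} x≢y y∉φ =
    s-∨ (Subb-substitutable x≢y (y∉φ ∘ o-∨ˡ)) (Subb-substitutable x≢y (y∉φ ∘ o-∨ʳ))
  Subb-substitutable {φ = φ · ψ} x≢y y∉φ =
    s-· (Subb-substitutable x≢y (y∉φ ∘ o-·ˡ)) (Subb-substitutable x≢y (y∉φ ∘ o-·ʳ))
  Subb-substitutable {x} {φ = ∀p z φ} x≢y y∉φ with z ≟ x
  ... | yes refl = s-∀y (∉-Subf-Subb x≢y φ)
  ... | no z≢x = s-∀ z≢x (λ { refl → y∉φ o-∀b }) (Subb-substitutable x≢y (y∉φ ∘ o-∀))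
  Subb-substitutable {x} {φ = ∃p z φ} x≢y y∉φ with z ≟ x
  ... | yes refl = s-∃y (∉-Subf-Subb x≢y φ)
  ... | no z≢x = s-∃ z≢x (λ { refl → y∉φ o-∃b }) (Subb-substitutable x≢y (y∉φ ∘ o-∃))

  Occurs-≐ : Occurs z (var x ≐ var y) → z ≡ x ⊎ z ≡ y
  Occurs-≐ (o-¬ (o-·ʳ (o-¬ (o-∧ˡ (o-⇒ˡ o-var))))) = inj₁ refl
  Occurs-≐ (o-¬ (o-·ʳ (o-¬ (o-∧ˡ (o-⇒ʳ o-var))))) = inj₂ refl
  Occurs-≐ (o-¬ (o-·ʳ (o-¬ (o-∧ʳ (o-⇒ˡ o-var))))) = inj₂ refl
  Occurs-≐ (o-¬ (o-·ʳ (o-¬ (o-∧ʳ (o-⇒ʳ o-var))))) = inj₁ refl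

  ≐-vacuous : z ≢ x → z ≢ y → ⊢ (var x ≐ var y ⇒ ∀p z (var x ≐ var y))
  ≐-vacuous z≢x z≢y = ax-∀vac ([ z≢x , z≢y ]′ ∘ Occurs-≐)

  ≐-sym : ⊢ (var x ≐ var y ⇒ var y ≐ var x)
  ≐-sym = ⌊⌋-mono ax-∧comm

  leibniz : Substitutable x y φ → φ ⊣⊢[ var x ≐ var y ] Subf x y φ
  leibniz {x} {φ = var z} s-var with z ≟ x
  ... | yes refl = ∧-mapˡ (⌊⌋-elim ⨾ ∧-elimˡ) ⨾ ⇒-elim , ∧-mapˡ (⌊⌋-elim ⨾ ∧-elimʳ) ⨾ ⇒-elim
  ... | no _ = ⊣⊢[]-refl
  leibniz s-sym = ⊣⊢[]-refl
  leibniz s-⊥ = ⊣⊢[]-refl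
  leibniz (s-¬ s) = ¬-cong[] (leibniz s)
  leibniz (s-⇒ s t) = ⇒-cong[] (leibniz s) (leibniz t)
  leibniz (s-∧ s t) = ∧-cong[] (leibniz s) (leibniz t)
  leibniz (s-∨ s t) = ∨-cong[] (leibniz s) (leibniz t)
  leibniz (s-· s t) = ·-cong[] (leibniz s) (leibniz t)
  leibniz {x} {φ = ∀p z φ} (s-∀ z≢x z≢y s) with z ≟ x
  ... | yes z≡x = ⊥-elim (z≢x z≡x)
  ... | no _ = ∀-cong[] (≐-vacuous z≢x z≢y) (leibniz s)
  leibniz {x} {y} (s-∀y {φ = φ} x∉φ) with y ≟ x
  ... | yes _ = ⊣⊢[]-refl
  ... | no _ rewrite Subf-∉ {y = y} x∉φ = ⊣⊢[]-refl
  leibniz {x} {φ = ∃p z φ} (s-∃ z≢x z≢y s) with z ≟ x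
  ... | yes z≡x = ⊥-elim (z≢x z≡x)
  ... | no _ = ∃-cong[] (≐-vacuous z≢x z≢y) (leibniz s)
  leibniz {x} {y} (s-∃y {φ = φ} x∉φ) with y ≟ x
  ... | yes _ = ⊣⊢[]-refl
  ... | no _ rewrite Subf-∉ {y = y} x∉φ = ⊣⊢[]-refl

  ∀-rename : x ≢ y → y ∉ A → x ∉ B → ⊢ ((var x ≐ var y) ∧p A ⇒ B) → ⊢ (∀p x A ⇒ ∀p y B)
  ∀-rename x≢y y∉A x∉B f = ax-∀vac (∉-∀ (≢-sym x≢y) y∉A) ⨾ ∀-mono (∀-elim (ax-∃eq x≢y) f x∉B)

  Subb-∀ : x ≢ y → y ∉ φ → φ ⊣⊢ Subb x y φ → ∀p x φ ⊣⊢ ∀p y (Subf x y (Subb x y φ))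
  Subb-∀ {x} {y} {φ} x≢y y∉φ (f , g) =
    ∀-rename x≢y y∉φ x∉φ′ (∧-mapʳ f ⨾ proj₁ x≐y⊢φ′) ,
    ∀-rename (≢-sym x≢y) x∉φ′ y∉φ (∧-mapˡ ≐-sym ⨾ proj₂ x≐y⊢φ′ ⨾ g)
    where
    x∉φ′ : x ∉ Subf x y (Subb x y φ)
    x∉φ′ = ∉-Subf-Subb x≢y φ
    x≐y⊢φ′ : Subb x y φ ⊣⊢[ var x ≐ var y ] Subf x y (Subb x y φ)
    x≐y⊢φ′ = leibniz (Subb-substitutable x≢y y∉φ)

  Subb-⊣⊢ : (φ : Pattern Σ) → y ∉ φ → φ ⊣⊢ Subb x y φ
  Subb-⊣⊢ (var z) y∉φ = ⊣⊢-refl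
  Subb-⊣⊢ (sym s) y∉φ = ⊣⊢-refl
  Subb-⊣⊢ ⊥p y∉φ = ⊣⊢-refl
  Subb-⊣⊢ (¬p φ) y∉φ = ¬-cong (Subb-⊣⊢ φ (y∉φ ∘ o-¬))
  Subb-⊣⊢ (φ ⇒ ψ) y∉φ = ⇒-cong (Subb-⊣⊢ φ (y∉φ ∘ o-⇒ˡ)) (Subb-⊣⊢ ψ (y∉φ ∘ o-⇒ʳ))
  Subb-⊣⊢ (φ ∧p ψ) y∉φ = ∧-cong (Subb-⊣⊢ φ (y∉φ ∘ o-∧ˡ)) (Subb-⊣⊢ ψ (y∉φ ∘ o-∧ʳ))
  Subb-⊣⊢ (φ ∨p ψ) y∉φ = ∨-cong (Subb-⊣⊢ φ (y∉φ ∘ o-∨ˡ)) (Subb-⊣⊢ ψ (y∉φ ∘ o-∨ʳ))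
  Subb-⊣⊢ (φ · ψ) y∉φ = ·-cong (Subb-⊣⊢ φ (y∉φ ∘ o-·ˡ)) (Subb-⊣⊢ ψ (y∉φ ∘ o-·ʳ))
  Subb-⊣⊢ {x = x} (∀p z φ) y∉φ with z ≟ x
  ... | yes refl = Subb-∀ (λ { refl → y∉φ o-∀b }) (y∉φ ∘ o-∀) (Subb-⊣⊢ φ (y∉φ ∘ o-∀))
  ... | no _ = ∀-cong (Subb-⊣⊢ φ (y∉φ ∘ o-∀))
  Subb-⊣⊢ {x = x} (∃p z φ) y∉φ with z ≟ x
  ... | yes refl =
    ∃-via-∀ (Subb-∀ (λ { refl → y∉φ o-∃b }) (λ { (o-¬ o) → y∉φ (o-∃ o) }) (¬-cong (Subb-⊣⊢ φ (y∉φ ∘ o-∃))))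
  ... | no _ = ∃-cong (Subb-⊣⊢ φ (y∉φ ∘ o-∃))

mainTheorem10 : {Σ : Set} (def : Σ) (φ : Pattern Σ) (x y : EVar) →
    ¬ Occurs y φ → MG.⊢_ def (φ ⇔ Subb x y φ)
mainTheorem10 def φ x y y∉φ = ⊣⊢⇒⇔ def (Subb-⊣⊢ def φ y∉φ)
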